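{- For all nonnegative integers $n$ and $d$, $$p(n)=p^{(d)}_n\!\left(2n+d\binom{n}{2}\right),$$ i.e. the number of partitions of $n$ equals the number of partitions of $2n+d\binom{n}{2}$ into exactly $n$ parts any two of which differ by at least $d$.
   Context: $p(n)$ is the number of partitions of $n$ (weakly decreasing sequences of positive integers summing to $n$; $p(0)=1$). A partition of an integer $m$ into $k$ parts is a weakly decreasing sequence of $k$ positive integers summing to $m$; the parts are $d$-distant if any two parts differ by at least $d$. $p^{(d)}_k(m)$ denotes the number of partitions of $m$ into exactly $k$ $d$-distant parts, with $p^{(d)}_0(m)=1$ if $m=0$ and $0$ otherwise. -}

module Defs where

open import Data.Nat using (ℕ; _+_; _≤_; _<_)
open import Data.List using (List; length)
open import Data.Nat.ListAction using (sum)
open import Data.List.Relation.Unary.All using (All)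
open import Data.List.Relation.Unary.AllPairs using (AllPairs)
open import Data.Fin using (Fin)
open import Data.Product using (Σ; ∃; _×_)
open import Function.Bundles using (_↔_)
open import Relation.Binary.PropositionalEquality using (_≡_)

IsPartition : ℕ → List ℕ → Set
IsPartition n ps = AllPairs (λ x y → y ≤ x) ps × All (0 <_) ps × sum ps ≡ n

Partition : ℕ → Set
Partition n = Σ (List ℕ) (IsPartition n)

IsDistantPartition : ℕ → ℕ → ℕ → List ℕ → Set
IsDistantPartition d k m ps =
  AllPairs (λ x y → y ≤ x) ps × AllPairs (λ x y → y + d ≤ x) ps ×
  All (0 <_) ps × length ps ≡ k × sum ps ≡ m

DistantPartition : ℕ → ℕ → ℕ → Set
DistantPartition d k m = Σ (List ℕ) (IsDistantPartition d k m)

HasCard : Set → ℕ → Set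
HasCard A c = A ↔ Fin c

PartitionCount : ℕ → ℕ → Set
PartitionCount n c = HasCard (Partition n) c

DistantPartitionCount : ℕ → ℕ → ℕ → ℕ → Set
DistantPartitionCount d k m c = HasCard (DistantPartition d k m) c

-- Pad a partition of n with zeros to exactly n weakly decreasing parts, then raise
-- the part that is followed by i further parts by 1 + d i.  This staircase turns weak
-- inequalities into gaps of at least d and zeros into positive parts, it is undone by
-- subtracting the same staircase, and it adds n + d (n choose 2) to the sum.  Both
-- sides are thus in bijection with the padded partitions of n, a finite set.
module Submission where

open import Defs
open import Data.Empty using (⊥-elim)
open import Data.Fin using (Fin; zero; suc; toℕ; fromℕ<)
open import Data.Fin.Properties using (+↔⊎; *↔×; toℕ≤pred[n]; toℕ-fromℕ<; fromℕ<-toℕ)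
open import Data.List using (List; []; _∷_; length; _++_; replicate)
open import Data.List.Properties using (length-++; length-replicate)
open import Data.List.Relation.Unary.All as All using (All; []; _∷_)
open import Data.List.Relation.Unary.All.Properties using (replicate⁺)
open import Data.List.Relation.Unary.AllPairs as AllPairs using (AllPairs; []; _∷_)
import Data.List.Relation.Unary.AllPairs.Properties as AllPairsₚ
open import Data.Nat using (ℕ; zero; suc; _+_; _*_; _∸_; _≤_; _<_; _≤?_; _≟_; z≤n; s≤s)
open import Data.Nat.Combinatorics using (_C_; nC1≡n; nCk+nC[k+1]≡[n+1]C[k+1])
open import Data.Nat.ListAction using (sum)
open import Data.Nat.ListAction.Properties using (sum-++)
open import Data.Nat.Properties
open import Data.Nat.Tactic.RingSolver using (solve-∀)
open import Data.Product using (Σ; ∃; _×_; _,_)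
open import Data.Product.Function.Dependent.Propositional using (Σ-↔)
open import Data.Product.Function.NonDependent.Propositional using (_×-↔_)
open import Data.Product.Properties using (Σ-≡,≡→≡)
open import Data.Sum using (_⊎_; inj₁; inj₂)
open import Data.Sum.Function.Propositional using (_⊎-↔_)
open import Function using (_∘_)
open import Function.Bundles using (_↔_; mk↔ₛ′; Inverse)
open import Function.Properties.Inverse using (↔-refl; ↔-sym; ↔-trans)
open import Relation.Binary.PropositionalEquality
open import Relation.Nullary using (Dec; yes; no; Irrelevant)
open import Relation.Nullary.Decidable using (_×-dec_)

private
  variable
    A B : Set

×-irrelevant : Irrelevant A → Irrelevant B → Irrelevant (A × B)
×-irrelevant irrA irrB (a , b) (a′ , b′) = cong₂ _,_ (irrA a a′) (irrB b b′)

Σ-≡-irrelevant : {P : A → Set} → (∀ a → Irrelevant (P a)) →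
                 {a a′ : A} {p : P a} {p′ : P a′} → a ≡ a′ → (a , p) ≡ (a′ , p′)
Σ-≡-irrelevant irr {a} {p = p} {p′} refl = Σ-≡,≡→≡ (refl , irr a p p′)

Finite : Set → Set
Finite A = ∃ (HasCard A)

finite-↔ : A ↔ B → Finite B → Finite A
finite-↔ f (c , g) = c , ↔-trans f g

finite-⊎ : Finite A → Finite B → Finite (A ⊎ B)
finite-⊎ (a , f) (b , g) = a + b , ↔-trans (f ⊎-↔ g) (↔-sym +↔⊎)

finite-× : Finite A → Finite B → Finite (A × B)
finite-× (a , f) (b , g) = a * b , ↔-trans (f ×-↔ g) (↔-sym *↔×)

finite-proposition : Dec A → Irrelevant A → Finite A
finite-proposition (yes a) irr = 1 , mk↔ₛ′ (λ _ → zero) (λ _ → a) (λ { zero → refl }) (irr a)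
finite-proposition (no ¬a) _ = 0 , mk↔ₛ′ (⊥-elim ∘ ¬a) (λ ()) (λ ()) (⊥-elim ∘ ¬a)

Σ-Fin-suc↔ : {n : ℕ} (Q : Fin (suc n) → Set) → Σ (Fin (suc n)) Q ↔ (Q zero ⊎ Σ (Fin n) (Q ∘ suc))
Σ-Fin-suc↔ Q = mk↔ₛ′
  (λ { (zero , q) → inj₁ q ; (suc i , q) → inj₂ (i , q) })
  (λ { (inj₁ q) → zero , q ; (inj₂ (i , q)) → suc i , q })
  (λ { (inj₁ q) → refl ; (inj₂ (i , q)) → refl })
  (λ { (zero , q) → refl ; (suc i , q) → refl })

finite-Σ-Fin : (n : ℕ) {Q : Fin n → Set} → (∀ i → Dec (Q i)) → (∀ i → Irrelevant (Q i)) →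
               Finite (Σ (Fin n) Q)
finite-Σ-Fin zero _ _ = 0 , mk↔ₛ′ (λ { (() , _) }) (λ ()) (λ ()) (λ { (() , _) })
finite-Σ-Fin (suc n) {Q} Q? irr = finite-↔ (Σ-Fin-suc↔ Q)
  (finite-⊎ (finite-proposition (Q? zero) (irr zero)) (finite-Σ-Fin n (Q? ∘ suc) (irr ∘ suc)))

finite-Σ : {P : A → Set} → Finite A → (∀ a → Dec (P a)) → (∀ a → Irrelevant (P a)) →
           Finite (Σ A P)
finite-Σ (n , f) P? irr =
  finite-↔ (↔-sym (Σ-↔ (↔-sym f) ↔-refl)) (finite-Σ-Fin n (P? ∘ from) (irr ∘ from))
  where open Inverse f

finite-≤ : (b : ℕ) → Finite (Σ ℕ (_≤ b))
finite-≤ b = suc b , mk↔ₛ′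
  (λ { (x , x≤b) → fromℕ< (s≤s x≤b) })
  (λ i → toℕ i , toℕ≤pred[n] i)
  (λ i → fromℕ<-toℕ i _)
  (λ { (x , x≤b) → Σ-≡-irrelevant (λ _ → ≤-irrelevant) (toℕ-fromℕ< (s≤s x≤b)) })

BoundedList : ℕ → ℕ → Set
BoundedList b k = Σ (List ℕ) (λ xs → length xs ≡ k × All (_≤ b) xs)

finite-BoundedList : (b k : ℕ) → Finite (BoundedList b k)
finite-BoundedList b zero = 1 , mk↔ₛ′ (λ _ → zero) (λ _ → [] , refl , [])
  (λ { zero → refl }) (λ { ([] , refl , []) → refl })
finite-BoundedList b (suc k) =
  finite-↔ cons↔ (finite-× (finite-≤ b) (finite-BoundedList b k))
  where
  cons↔ : BoundedList b (suc k) ↔ (Σ ℕ (_≤ b) × BoundedList b k)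
  cons↔ = mk↔ₛ′
    (λ { (x ∷ xs , refl , x≤b ∷ xs≤b) → (x , x≤b) , (xs , refl , xs≤b) })
    (λ { ((x , x≤b) , (xs , refl , xs≤b)) → x ∷ xs , refl , x≤b ∷ xs≤b })
    (λ { ((x , x≤b) , (xs , refl , xs≤b)) → refl })
    (λ { (x ∷ xs , refl , x≤b ∷ xs≤b) → refl })

Descending : List ℕ → Set
Descending = AllPairs (λ x y → y ≤ x)

descending-irrelevant : (xs : List ℕ) → Irrelevant (Descending xs)
descending-irrelevant _ = AllPairs.irrelevant ≤-irrelevant

IsWeakPartition : ℕ → ℕ → List ℕ → Set
IsWeakPartition k m xs = Descending xs × length xs ≡ k × sum xs ≡ m

WeakPartition : ℕ → ℕ → Set
WeakPartition k m = Σ (List ℕ) (IsWeakPartition k m)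

isWeakPartition-irrelevant : (k m : ℕ) (xs : List ℕ) → Irrelevant (IsWeakPartition k m xs)
isWeakPartition-irrelevant k m xs =
  ×-irrelevant (descending-irrelevant xs) (×-irrelevant ≡-irrelevant ≡-irrelevant)

All≤sum : (xs : List ℕ) → All (_≤ sum xs) xs
All≤sum [] = []
All≤sum (x ∷ xs) = m≤m+n x (sum xs) ∷ All.map (λ y≤ → ≤-trans y≤ (m≤n+m (sum xs) x)) (All≤sum xs)

finite-WeakPartition : (k m : ℕ) → Finite (WeakPartition k m)
finite-WeakPartition k m = finite-↔ bounded↔
  (finite-Σ (finite-BoundedList m k)
    (λ (xs , _) → AllPairs.allPairs? (λ x y → y ≤? x) xs ×-dec (sum xs ≟ m))
    bounded-irrelevant)
  where
  Bounded : BoundedList m k → Set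
  Bounded (xs , _) = Descending xs × sum xs ≡ m

  bounded-irrelevant : (xs : BoundedList m k) → Irrelevant (Bounded xs)
  bounded-irrelevant (xs , _) = ×-irrelevant (descending-irrelevant xs) ≡-irrelevant

  bounded↔ : WeakPartition k m ↔ Σ (BoundedList m k) Bounded
  bounded↔ = mk↔ₛ′
    (λ { (xs , desc , len , Σ≡m) →
           (xs , len , subst (λ s → All (_≤ s) xs) Σ≡m (All≤sum xs)) , desc , Σ≡m })
    (λ { ((xs , len , _) , desc , Σ≡m) → xs , desc , len , Σ≡m })
    (λ _ → Σ-≡-irrelevant bounded-irrelevant
             (Σ-≡-irrelevant (λ _ → ×-irrelevant ≡-irrelevant (All.irrelevant ≤-irrelevant)) refl))
    (λ _ → refl)

isPartition-irrelevant : (n : ℕ) (xs : List ℕ) → Irrelevant (IsPartition n xs)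
isPartition-irrelevant n xs =
  ×-irrelevant (descending-irrelevant xs) (×-irrelevant (All.irrelevant ≤-irrelevant) ≡-irrelevant)

zeros : ℕ → List ℕ
zeros j = replicate j 0

dropZeros : List ℕ → List ℕ
dropZeros [] = []
dropZeros (zero ∷ xs) = dropZeros xs
dropZeros (suc x ∷ xs) = suc x ∷ dropZeros xs

length≤sum : {xs : List ℕ} → All (0 <_) xs → length xs ≤ sum xs
length≤sum [] = z≤n
length≤sum (x>0 ∷ xs>0) = +-mono-≤ x>0 (length≤sum xs>0)

sum-zeros : (j : ℕ) → sum (zeros j) ≡ 0
sum-zeros zero = refl
sum-zeros (suc j) = sum-zeros j

descending-zeros : (j : ℕ) → Descending (zeros j)
descending-zeros zero = []
descending-zeros (suc j) = replicate⁺ j z≤n ∷ descending-zeros j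

descending-++-zeros : {xs : List ℕ} (j : ℕ) → Descending xs → Descending (xs ++ zeros j)
descending-++-zeros j desc =
  AllPairsₚ.++⁺ desc (descending-zeros j) (All.universal (λ _ → replicate⁺ j z≤n) _)

All-dropZeros : {P : ℕ → Set} (xs : List ℕ) → All P xs → All P (dropZeros xs)
All-dropZeros [] [] = []
All-dropZeros (zero ∷ xs) (_ ∷ pxs) = All-dropZeros xs pxs
All-dropZeros (suc x ∷ xs) (px ∷ pxs) = px ∷ All-dropZeros xs pxs

descending-dropZeros : (xs : List ℕ) → Descending xs → Descending (dropZeros xs)
descending-dropZeros [] [] = []
descending-dropZeros (zero ∷ xs) (_ ∷ desc) = descending-dropZeros xs desc
descending-dropZeros (suc x ∷ xs) (x≥xs ∷ desc) = All-dropZeros xs x≥xs ∷ descending-dropZeros xs desc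

dropZeros-positive : (xs : List ℕ) → All (0 <_) (dropZeros xs)
dropZeros-positive [] = []
dropZeros-positive (zero ∷ xs) = dropZeros-positive xs
dropZeros-positive (suc x ∷ xs) = s≤s z≤n ∷ dropZeros-positive xs

sum-dropZeros : (xs : List ℕ) → sum (dropZeros xs) ≡ sum xs
sum-dropZeros [] = refl
sum-dropZeros (zero ∷ xs) = sum-dropZeros xs
sum-dropZeros (suc x ∷ xs) = cong (suc x +_) (sum-dropZeros xs)

dropZeros-++-zeros : {xs : List ℕ} (j : ℕ) → All (0 <_) xs → dropZeros (xs ++ zeros j) ≡ xs
dropZeros-++-zeros zero [] = refl
dropZeros-++-zeros (suc j) [] = dropZeros-++-zeros j []
dropZeros-++-zeros {suc x ∷ xs} j (_ ∷ xs>0) = cong (suc x ∷_) (dropZeros-++-zeros j xs>0)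

All≤0⇒zeros : (xs : List ℕ) → All (_≤ 0) xs → xs ≡ zeros (length xs)
All≤0⇒zeros [] [] = refl
All≤0⇒zeros (zero ∷ xs) (z≤n ∷ xs≤0) = cong (0 ∷_) (All≤0⇒zeros xs xs≤0)

descending⇒dropZeros-++-zeros : (xs : List ℕ) → Descending xs →
  xs ≡ dropZeros xs ++ zeros (length xs ∸ length (dropZeros xs))
descending⇒dropZeros-++-zeros [] [] = refl
descending⇒dropZeros-++-zeros (zero ∷ xs) (xs≤0 ∷ _)
  rewrite All≤0⇒zeros xs xs≤0 | dropZeros-++-zeros (length xs) [] | length-replicate (length xs) {0} = refl
descending⇒dropZeros-++-zeros (suc x ∷ xs) (_ ∷ desc) =
  cong (suc x ∷_) (descending⇒dropZeros-++-zeros xs desc)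

partition↔weakPartition : {n k : ℕ} → n ≤ k → Partition n ↔ WeakPartition k n
partition↔weakPartition {n} {k} n≤k = mk↔ₛ′ pad unpad
  (λ { (xs , desc , refl , _) →
         Σ-≡-irrelevant (isWeakPartition-irrelevant k n) (sym (descending⇒dropZeros-++-zeros xs desc)) })
  (λ { (xs , _ , xs>0 , _) → Σ-≡-irrelevant (isPartition-irrelevant n) (dropZeros-++-zeros _ xs>0) })
  where
  pad : Partition n → WeakPartition k n
  pad (xs , desc , xs>0 , Σ≡n) = xs ++ zeros (k ∸ length xs) , descending-++-zeros _ desc ,
    (begin
      length (xs ++ zeros (k ∸ length xs))      ≡⟨ length-++ xs ⟩
      length xs + length (zeros (k ∸ length xs)) ≡⟨ cong (length xs +_) (length-replicate (k ∸ length xs)) ⟩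
      length xs + (k ∸ length xs)                ≡⟨ m+[n∸m]≡n length≤k ⟩
      k                                          ∎) ,
    (begin
      sum (xs ++ zeros (k ∸ length xs))   ≡⟨ sum-++ xs _ ⟩
      sum xs + sum (zeros (k ∸ length xs)) ≡⟨ cong (sum xs +_) (sum-zeros (k ∸ length xs)) ⟩
      sum xs + 0                           ≡⟨ +-identityʳ _ ⟩
      sum xs                               ≡⟨ Σ≡n ⟩
      n                                    ∎)
    where
    open ≡-Reasoning
    length≤k : length xs ≤ k
    length≤k = ≤-trans (subst (length xs ≤_) Σ≡n (length≤sum xs>0)) n≤k

  unpad : WeakPartition k n → Partition n
  unpad (xs , desc , _ , Σ≡n) =
    dropZeros xs , descending-dropZeros xs desc , dropZeros-positive xs , trans (sum-dropZeros xs) Σ≡n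

isDistantPartition-irrelevant : (d k m : ℕ) (xs : List ℕ) → Irrelevant (IsDistantPartition d k m xs)
isDistantPartition-irrelevant d k m xs =
  ×-irrelevant (descending-irrelevant xs) (×-irrelevant (AllPairs.irrelevant ≤-irrelevant)
    (×-irrelevant (All.irrelevant ≤-irrelevant) (×-irrelevant ≡-irrelevant ≡-irrelevant)))

C2-suc : (n : ℕ) → suc n C 2 ≡ n + n C 2
C2-suc n = trans (sym (nCk+nC[k+1]≡[n+1]C[k+1] n 1)) (cong (_+ n C 2) (nC1≡n n))

module Staircase (d : ℕ) where

  Distant : List ℕ → Set
  Distant = AllPairs (λ x y → y + d ≤ x)

  rise : ℕ → ℕ
  rise i = suc (d * i)

  staircaseSum : ℕ → ℕ
  staircaseSum k = k + d * (k C 2)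

  raise : List ℕ → List ℕ
  raise [] = []
  raise (x ∷ xs) = x + rise (length xs) ∷ raise xs

  lower : List ℕ → List ℕ
  lower [] = []
  lower (x ∷ xs) = x ∸ rise (length xs) ∷ lower xs

  rise-suc : (i : ℕ) → rise (suc i) ≡ rise i + d
  rise-suc i = cong suc (trans (*-suc d i) (+-comm d (d * i)))

  length-raise : (xs : List ℕ) → length (raise xs) ≡ length xs
  length-raise [] = refl
  length-raise (x ∷ xs) = cong suc (length-raise xs)

  length-lower : (xs : List ℕ) → length (lower xs) ≡ length xs
  length-lower [] = refl
  length-lower (x ∷ xs) = cong suc (length-lower xs)

  sum-raise : (xs : List ℕ) → sum (raise xs) ≡ sum xs + staircaseSum (length xs)
  sum-raise [] = sym (*-zeroʳ d)
  sum-raise (x ∷ xs) = begin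
    x + suc (d * i) + sum (raise xs)             ≡⟨ cong (x + suc (d * i) +_) (sum-raise xs) ⟩
    x + suc (d * i) + (sum xs + (i + d * (i C 2))) ≡⟨ regroup x (d * i) (sum xs) i (d * (i C 2)) ⟩
    x + sum xs + suc (i + (d * i + d * (i C 2))) ≡⟨ cong (λ t → x + sum xs + suc (i + t)) (*-distribˡ-+ d i (i C 2)) ⟨
    x + sum xs + suc (i + d * (i + i C 2))       ≡⟨ cong (λ t → x + sum xs + suc (i + d * t)) (sym (C2-suc i)) ⟩
    x + sum xs + staircaseSum (suc i)            ∎
    where
    open ≡-Reasoning
    i = length xs
    regroup : ∀ x a s i c → x + suc a + (s + (i + c)) ≡ x + s + suc (i + (a + c))
    regroup = solve-∀

  All-raise : {x : ℕ} (xs : List ℕ) → All (_≤ x) xs → All (λ y → y + d ≤ x + rise (length xs)) (raise xs)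
  All-raise [] [] = []
  All-raise {x} (y ∷ ys) (y≤x ∷ ys≤x) =
    head ∷ All.map (λ le → ≤-trans le (+-monoʳ-≤ x rise-mono)) (All-raise ys ys≤x)
    where
    i = length ys
    rise-mono : rise i ≤ rise (suc i)
    rise-mono = subst (rise i ≤_) (sym (rise-suc i)) (m≤m+n (rise i) d)
    head : y + rise i + d ≤ x + rise (suc i)
    head rewrite rise-suc i | +-assoc y (rise i) d = +-monoˡ-≤ (rise i + d) y≤x

  distant-raise : (xs : List ℕ) → Descending xs → Distant (raise xs)
  distant-raise [] [] = []
  distant-raise (x ∷ xs) (x≥xs ∷ desc) = All-raise xs x≥xs ∷ distant-raise xs desc

  positive-raise : (xs : List ℕ) → All (0 <_) (raise xs)
  positive-raise [] = []
  positive-raise (x ∷ xs) = ≤-trans (s≤s z≤n) (m≤n+m (rise (length xs)) x) ∷ positive-raise xs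

  rise≤head : (x : ℕ) (xs : List ℕ) → Distant (x ∷ xs) → All (0 <_) (x ∷ xs) → rise (length xs) ≤ x
  rise≤head x [] _ (x>0 ∷ []) rewrite *-zeroʳ d = x>0
  rise≤head x (y ∷ ys) ((y+d≤x ∷ _) ∷ dist) (_ ∷ ys>0) = begin
    rise (suc (length ys)) ≡⟨ rise-suc (length ys) ⟩
    rise (length ys) + d   ≤⟨ +-monoˡ-≤ d (rise≤head y ys dist ys>0) ⟩
    y + d                  ≤⟨ y+d≤x ⟩
    x                      ∎
    where open ≤-Reasoning

  lower-raise : (xs : List ℕ) → lower (raise xs) ≡ xs
  lower-raise [] = refl
  lower-raise (x ∷ xs) rewrite length-raise xs = cong₂ _∷_ (m+n∸n≡m x (rise (length xs))) (lower-raise xs)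

  raise-lower : (xs : List ℕ) → Distant xs → All (0 <_) xs → raise (lower xs) ≡ xs
  raise-lower [] _ _ = refl
  raise-lower (x ∷ xs) (x≥xs ∷ dist) (x>0 ∷ xs>0) rewrite length-lower xs =
    cong₂ _∷_ (m∸n+n≡m (rise≤head x xs (x≥xs ∷ dist) (x>0 ∷ xs>0))) (raise-lower xs dist xs>0)

  All-lower : (x : ℕ) (xs : List ℕ) → Distant (x ∷ xs) → All (0 <_) xs →
              All (_≤ x ∸ rise (length xs)) (lower xs)
  All-lower x [] _ _ = []
  All-lower x (y ∷ ys) ((y+d≤x ∷ _) ∷ dist) ys>0 =
    head ∷ All.map (λ le → ≤-trans le head) (All-lower y ys dist (All.tail ys>0))
    where
    i = length ys
    lowered+rise : y ∸ rise i + rise (suc i) ≡ y + d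
    lowered+rise = begin
      y ∸ rise i + rise (suc i)  ≡⟨ cong (y ∸ rise i +_) (rise-suc i) ⟩
      y ∸ rise i + (rise i + d)  ≡⟨ sym (+-assoc (y ∸ rise i) (rise i) d) ⟩
      y ∸ rise i + rise i + d    ≡⟨ cong (_+ d) (m∸n+n≡m (rise≤head y ys dist ys>0)) ⟩
      y + d                      ∎
      where open ≡-Reasoning
    head : y ∸ rise i ≤ x ∸ rise (suc i)
    head = m+n≤o⇒m≤o∸n (y ∸ rise i) (subst (_≤ x) (sym lowered+rise) y+d≤x)

  descending-lower : (xs : List ℕ) → Distant xs → All (0 <_) xs → Descending (lower xs)
  descending-lower [] _ _ = []
  descending-lower (x ∷ xs) dist (_ ∷ xs>0) =
    All-lower x xs dist xs>0 ∷ descending-lower xs (AllPairs.tail dist) xs>0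

  distant⇒descending : {xs : List ℕ} → Distant xs → Descending xs
  distant⇒descending = AllPairs.map (λ {_} {y} y+d≤x → m+n≤o⇒m≤o y y+d≤x)

  weakPartition↔distantPartition : (k m : ℕ) →
    WeakPartition k m ↔ DistantPartition d k (m + staircaseSum k)
  weakPartition↔distantPartition k m = mk↔ₛ′ raise′ lower′
    (λ { (xs , _ , dist , xs>0 , _) →
           Σ-≡-irrelevant (isDistantPartition-irrelevant d k _) (raise-lower xs dist xs>0) })
    (λ { (xs , _) → Σ-≡-irrelevant (isWeakPartition-irrelevant k m) (lower-raise xs) })
    where
    open ≡-Reasoning
    raise′ : WeakPartition k m → DistantPartition d k (m + staircaseSum k)
    raise′ (xs , desc , len , Σ≡m) =
      raise xs , distant⇒descending (distant-raise xs desc) , distant-raise xs desc , positive-raise xs ,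
      trans (length-raise xs) len ,
      trans (sum-raise xs) (cong₂ (λ s l → s + staircaseSum l) Σ≡m len)
    lower′ : DistantPartition d k (m + staircaseSum k) → WeakPartition k m
    lower′ (xs , _ , dist , xs>0 , len , Σ≡) =
      lower xs , descending-lower xs dist xs>0 , len′ ,
      +-cancelʳ-≡ (staircaseSum k) (sum (lower xs)) m (begin
        sum (lower xs) + staircaseSum k                  ≡⟨ cong (λ l → sum (lower xs) + staircaseSum l) (sym len′) ⟩
        sum (lower xs) + staircaseSum (length (lower xs)) ≡⟨ sym (sum-raise (lower xs)) ⟩
        sum (raise (lower xs))                           ≡⟨ cong sum (raise-lower xs dist xs>0) ⟩
        sum xs                                           ≡⟨ Σ≡ ⟩
        m + staircaseSum k                               ∎)
      where
      len′ : length (lower xs) ≡ k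
      len′ = trans (length-lower xs) len

open Staircase using (staircaseSum; weakPartition↔distantPartition)

theorem1 : (n d : ℕ) → ∃ λ c → PartitionCount n c × DistantPartitionCount d n (2 * n + d * (n C 2)) c
theorem1 n d with finite-WeakPartition n n
... | c , weak↔Fin = c , ↔-trans (partition↔weakPartition ≤-refl) weak↔Fin ,
  subst (λ m → DistantPartition d n m ↔ Fin c) offset
    (↔-trans (↔-sym (weakPartition↔distantPartition d n n)) weak↔Fin)
  where
  offset : n + staircaseSum d n ≡ 2 * n + d * (n C 2)
  offset = trans (sym (+-assoc n n _)) (cong (λ t → n + t + d * (n C 2)) (sym (+-identityʳ n)))
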